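{- Let $X$ be a rooted tree of depth $d$ in which every node on level $\ell$ has exactly $k_\ell$ children, and let $k_{\min}:=\min_{0\le \ell\le d-1} k_\ell$. Let $c\in\mathbb{Z}^+$, $0<q<\frac{c}{c+1}$, and suppose $k_{\min}>c$. Define $p_0:=q$ and $p_{h+1} := q+(1-q)p_h^{k_{d-h-1}}$ for $h\ge 0$. Then there exists $p'<1$, depending only on $c$ and $q$, such that $p_i\le p'$ for every $i\ge 0$ (for which $p_i$ is defined).
   Context: Here $p_h$ is the probability, in the TED deletion model with deletion probability $q$ on $X$, that no path from a given node at height $h$ down to a leaf survives in the trace; it satisfies the stated recursion.
   Formalization: The deletion probability q ranges over the rationals, and the bound p' is taken among the rationals as well. -}

module Defs where

open import Data.Nat using (ℕ; zero; suc; _∸_)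
open import Data.Rational using (ℚ; 1ℚ; _+_; _*_; _-_)

_^_ : ℚ → ℕ → ℚ
x ^ zero  = 1ℚ
x ^ suc n = x * (x ^ n)

p : (d : ℕ) (k : ℕ → ℕ) (q : ℚ) → ℕ → ℚ
p d k q zero    = q
p d k q (suc h) = q + (1ℚ - q) * (p d k q h ^ k (d ∸ h ∸ 1))

-- With u = 1/(c+1) and P = q + u < 1, every p_i lies in [0, P]: if 0 ≤ x ≤ P then,
-- as k ≥ c + 1 and x ≤ 1, q + (1 - q) x^k ≤ q + (1 - q) P^(c+1), so it suffices that
-- (1 - q) P^(c+1) ≤ u.  Since (c+1)(1 - q) = 1 + (c+1)(1 - P), this is the
-- Bernoulli-type inequality x^n (1 + n (1 - x)) ≤ 1 for 0 ≤ x ≤ 1.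
module Submission where

open import Defs
open import Data.Nat using (ℕ; suc; _≤_; _<_)
open import Data.Integer using (+_)
open import Data.Rational using (ℚ; 0ℚ; 1ℚ; _/_) renaming (_<_ to _<ℚ_; _≤_ to _≤ℚ_)
open import Data.Product using (Σ; _×_)

open import Data.Nat using (zero; z≤n; s≤s; _∸_)
import Data.Nat as ℕ
import Data.Nat.Properties as ℕ
import Data.Integer.Solver as ℤ
open import Data.Rational using (_+_; _*_; _-_; -_; toℚᵘ; nonNegative)
open import Data.Rational.Properties
import Data.Rational.Unnormalised as ℚᵘ
import Data.Rational.Unnormalised.Properties as ℚᵘ
open import Data.Rational.Solver using (module +-*-Solver)
open import Data.Product using (_,_; proj₂)
open import Relation.Binary.PropositionalEquality using (_≡_; refl; cong; sym; subst; module ≡-Reasoning)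

m∸n∸1<m : ∀ {m n} → n < m → m ∸ n ∸ 1 < m
m∸n∸1<m {suc m} {zero}  _         = ℕ.n<1+n m
m∸n∸1<m {suc m} {suc n} (s≤s n<m) = ℕ.m<n⇒m<1+n (m∸n∸1<m n<m)

fromℕ : ℕ → ℚ
fromℕ m = + m / 1

/-+-/ : ∀ a b n → + a / suc n + + b / suc n ≡ + (a ℕ.+ b) / suc n
/-+-/ a b n = toℚᵘ-injective (begin
  toℚᵘ (+ a / suc n + + b / suc n)          ≈⟨ toℚᵘ-homo-+ (+ a / suc n) (+ b / suc n) ⟩
  toℚᵘ (+ a / suc n) ℚᵘ.+ toℚᵘ (+ b / suc n) ≈⟨ ℚᵘ.+-cong (toℚᵘ-fromℚᵘ (ℚᵘ.mkℚᵘ (+ a) n))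
                                                           (toℚᵘ-fromℚᵘ (ℚᵘ.mkℚᵘ (+ b) n)) ⟩
  ℚᵘ.mkℚᵘ (+ a) n ℚᵘ.+ ℚᵘ.mkℚᵘ (+ b) n       ≈⟨ ℚᵘ.*≡* (solve 3 (λ a b m → (a :* m :+ b :* m) :* m := (a :+ b) :* (m :* m))
                                                                refl (+ a) (+ b) (+ suc n)) ⟩
  ℚᵘ.mkℚᵘ (+ (a ℕ.+ b)) n                    ≈⟨ toℚᵘ-fromℚᵘ (ℚᵘ.mkℚᵘ (+ (a ℕ.+ b)) n) ⟨
  toℚᵘ (+ (a ℕ.+ b) / suc n)                 ∎)
  where open ℚᵘ.≃-Reasoning
        open ℤ.+-*-Solver

[1+n]/[1+n]≡1 : ∀ n → + suc n / suc n ≡ 1ℚ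
[1+n]/[1+n]≡1 n = toℚᵘ-injective (ℚᵘ.≃-trans (toℚᵘ-fromℚᵘ (ℚᵘ.mkℚᵘ (+ suc n) n))
  (ℚᵘ.*≡* (solve 1 (λ m → (con (+ 1) :+ m) :* con (+ 1) := con (+ 1) :* (con (+ 1) :+ m)) refl (+ n))))
  where open ℤ.+-*-Solver

[1+n]*[1/[1+n]]≡1 : ∀ n → fromℕ (suc n) * (+ 1 / suc n) ≡ 1ℚ
[1+n]*[1/[1+n]]≡1 n = toℚᵘ-injective (begin
  toℚᵘ (fromℕ (suc n) * (+ 1 / suc n))          ≈⟨ toℚᵘ-homo-* (fromℕ (suc n)) (+ 1 / suc n) ⟩
  toℚᵘ (fromℕ (suc n)) ℚᵘ.* toℚᵘ (+ 1 / suc n) ≈⟨ ℚᵘ.*-cong (toℚᵘ-fromℚᵘ (ℚᵘ.mkℚᵘ (+ suc n) 0))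
                                                               (toℚᵘ-fromℚᵘ (ℚᵘ.mkℚᵘ (+ 1) n)) ⟩
  ℚᵘ.mkℚᵘ (+ suc n) 0 ℚᵘ.* ℚᵘ.mkℚᵘ (+ 1) n        ≈⟨ ℚᵘ.*≡* (solve 1 (λ m → (con (+ 1) :+ m) :* con (+ 1) :* con (+ 1)
                                                                      := con (+ 1) :* (con (+ 1) :* (con (+ 1) :+ m)))
                                                                    refl (+ n)) ⟩
  toℚᵘ 1ℚ                                        ∎)
  where open ℚᵘ.≃-Reasoning
        open ℤ.+-*-Solver

n/[1+n]+1/[1+n]≡1 : ∀ n → + n / suc n + + 1 / suc n ≡ 1ℚ
n/[1+n]+1/[1+n]≡1 n = begin
  + n / suc n + + 1 / suc n ≡⟨ /-+-/ n 1 n ⟩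
  + (n ℕ.+ 1) / suc n       ≡⟨ cong (λ m → + m / suc n) (ℕ.+-comm n 1) ⟩
  + suc n / suc n           ≡⟨ [1+n]/[1+n]≡1 n ⟩
  1ℚ                        ∎
  where open ≡-Reasoning

fromℕ-suc : ∀ m → fromℕ (suc m) ≡ 1ℚ + fromℕ m
fromℕ-suc m = sym (/-+-/ 1 m 0)

+m/n-nonNeg : ∀ m n .{{_ : ℕ.NonZero n}} → 0ℚ ≤ℚ + m / n
+m/n-nonNeg m n = nonNegative⁻¹ (+ m / n) {{normalize-nonNeg m n}}

0≤q⇒p≤p+q : ∀ p {q} → 0ℚ ≤ℚ q → p ≤ℚ p + q
0≤q⇒p≤p+q p 0≤q = subst (_≤ℚ p + _) (+-identityʳ p) (+-monoʳ-≤ p 0≤q)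

p≤q⇒0≤q-p : ∀ {p q} → p ≤ℚ q → 0ℚ ≤ℚ q - p
p≤q⇒0≤q-p {p} {q} p≤q = subst (_≤ℚ q - p) (+-inverseʳ p) (+-monoˡ-≤ (- p) p≤q)

0≤q⇒p-q≤p : ∀ p {q} → 0ℚ ≤ℚ q → p - q ≤ℚ p
0≤q⇒p-q≤p p {q} 0≤q = subst (p - q ≤ℚ_) (+-identityʳ p) (+-monoʳ-≤ p (neg-antimono-≤ 0≤q))

*-nonNeg : ∀ {p q} → 0ℚ ≤ℚ p → 0ℚ ≤ℚ q → 0ℚ ≤ℚ p * q
*-nonNeg {p} {q} 0≤p 0≤q =
  nonNegative⁻¹ (p * q) {{nonNeg*nonNeg⇒nonNeg p {{nonNegative 0≤p}} q {{nonNegative 0≤q}}}}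

*-mono-≤-nonNeg : ∀ {p q r s} → 0ℚ ≤ℚ p → 0ℚ ≤ℚ r → p ≤ℚ q → r ≤ℚ s → p * r ≤ℚ q * s
*-mono-≤-nonNeg {p} {q} {r} {s} 0≤p 0≤r p≤q r≤s = begin
  p * r ≤⟨ *-monoʳ-≤-nonNeg r {{nonNegative 0≤r}} p≤q ⟩
  q * r ≤⟨ *-monoˡ-≤-nonNeg q {{nonNegative (≤-trans 0≤p p≤q)}} r≤s ⟩
  q * s ∎
  where open ≤-Reasoning

^-nonNeg : ∀ {x} n → 0ℚ ≤ℚ x → 0ℚ ≤ℚ x ^ n
^-nonNeg zero    _   = nonNegative⁻¹ 1ℚ
^-nonNeg (suc n) 0≤x = *-nonNeg 0≤x (^-nonNeg n 0≤x)

^-≤-1 : ∀ {x} n → 0ℚ ≤ℚ x → x ≤ℚ 1ℚ → x ^ n ≤ℚ 1ℚ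
^-≤-1 zero    _   _   = ≤-refl
^-≤-1 (suc n) 0≤x x≤1 = *-mono-≤-nonNeg 0≤x (^-nonNeg n 0≤x) x≤1 (^-≤-1 n 0≤x x≤1)

^-monoˡ-antimonoʳ-≤ : ∀ {x y m n} → 0ℚ ≤ℚ x → x ≤ℚ y → y ≤ℚ 1ℚ → m ≤ n → x ^ n ≤ℚ y ^ m
^-monoˡ-antimonoʳ-≤ {n = n} 0≤x x≤y y≤1 z≤n = ^-≤-1 n 0≤x (≤-trans x≤y y≤1)
^-monoˡ-antimonoʳ-≤ {n = suc n} 0≤x x≤y y≤1 (s≤s m≤n) =
  *-mono-≤-nonNeg 0≤x (^-nonNeg n 0≤x) x≤y (^-monoˡ-antimonoʳ-≤ 0≤x x≤y y≤1 m≤n)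

x^n[1+n[1-x]]≤1 : ∀ {x} n → 0ℚ ≤ℚ x → x ≤ℚ 1ℚ → x ^ n * (1ℚ + fromℕ n * (1ℚ - x)) ≤ℚ 1ℚ
x^n[1+n[1-x]]≤1 {x} zero _ _ =
  ≤-reflexive (solve 1 (λ x → con 1ℚ :* (con 1ℚ :+ con 0ℚ :* (con 1ℚ :- x)) := con 1ℚ) refl x)
  where open +-*-Solver
x^n[1+n[1-x]]≤1 {x} (suc m) 0≤x x≤1 = begin
  x ^ suc m * (1ℚ + fromℕ (suc m) * (1ℚ - x))  ≡⟨ cong (λ n → x ^ suc m * (1ℚ + n * (1ℚ - x))) (fromℕ-suc m) ⟩
  x * x ^ m * (1ℚ + (1ℚ + M) * (1ℚ - x))       ≡⟨ solve 3 (λ x y M → x :* y :* (con 1ℚ :+ (con 1ℚ :+ M) :* (con 1ℚ :- x))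
                                                   := y :* (con 1ℚ :+ M :* (con 1ℚ :- x)) :- y :* ((con 1ℚ :+ M) :* ((con 1ℚ :- x) :* (con 1ℚ :- x))))
                                                 refl x (x ^ m) M ⟩
  x ^ m * (1ℚ + M * (1ℚ - x)) - x ^ m * ((1ℚ + M) * ((1ℚ - x) * (1ℚ - x)))
                                               ≤⟨ 0≤q⇒p-q≤p _ (*-nonNeg (^-nonNeg m 0≤x)
                                                    (*-nonNeg (subst (0ℚ ≤ℚ_) (fromℕ-suc m) (+m/n-nonNeg (suc m) 1))
                                                      (*-nonNeg 0≤1-x 0≤1-x))) ⟩
  x ^ m * (1ℚ + M * (1ℚ - x))                  ≤⟨ x^n[1+n[1-x]]≤1 m 0≤x x≤1 ⟩
  1ℚ                                           ∎
  where
  open ≤-Reasoning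
  open +-*-Solver
  M : ℚ
  M = fromℕ m
  0≤1-x : 0ℚ ≤ℚ 1ℚ - x
  0≤1-x = p≤q⇒0≤q-p x≤1

module _ {q P : ℚ} {n : ℕ} (0≤q : 0ℚ ≤ℚ q) (q≤P : q ≤ℚ P) (P≤1 : P ≤ℚ 1ℚ)
         (q+[1-q]Pⁿ≤P : q + (1ℚ - q) * P ^ n ≤ℚ P) where

  p∈[0,P] : ∀ d k → (∀ ℓ → ℓ < d → n ≤ k ℓ) → ∀ i → i ≤ d → 0ℚ ≤ℚ p d k q i × p d k q i ≤ℚ P
  p∈[0,P] d k n≤k zero    _   = 0≤q , q≤P
  p∈[0,P] d k n≤k (suc h) h<d with p∈[0,P] d k n≤k h (ℕ.<⇒≤ h<d)
  ... | 0≤x , x≤P = +-mono-≤ 0≤q (*-nonNeg 0≤1-q (^-nonNeg kₕ 0≤x)) , (begin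
    q + (1ℚ - q) * p d k q h ^ kₕ ≤⟨ +-monoʳ-≤ q (*-monoˡ-≤-nonNeg (1ℚ - q) {{nonNegative 0≤1-q}} xᵏ≤Pⁿ) ⟩
    q + (1ℚ - q) * P ^ n          ≤⟨ q+[1-q]Pⁿ≤P ⟩
    P                             ∎)
    where
    open ≤-Reasoning
    kₕ : ℕ
    kₕ = k (d ∸ h ∸ 1)
    0≤1-q : 0ℚ ≤ℚ 1ℚ - q
    0≤1-q = p≤q⇒0≤q-p (≤-trans q≤P P≤1)
    xᵏ≤Pⁿ : p d k q h ^ kₕ ≤ℚ P ^ n
    xᵏ≤Pⁿ = ^-monoˡ-antimonoʳ-≤ 0≤x x≤P P≤1 (n≤k _ (m∸n∸1<m h<d))

[1-q]*[q+1/[1+n]]^[1+n]≤1/[1+n] : ∀ n {q} → 0ℚ ≤ℚ q → q + + 1 / suc n ≤ℚ 1ℚ →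
  (1ℚ - q) * (q + + 1 / suc n) ^ suc n ≤ℚ + 1 / suc n
[1-q]*[q+1/[1+n]]^[1+n]≤1/[1+n] n {q} 0≤q P≤1 = begin
  (1ℚ - q) * Pⁿ                   ≡⟨ *-identityˡ _ ⟨
  1ℚ * ((1ℚ - q) * Pⁿ)            ≡⟨ cong (_* ((1ℚ - q) * Pⁿ)) ([1+n]*[1/[1+n]]≡1 n) ⟨
  N * u * ((1ℚ - q) * Pⁿ)         ≡⟨ solve 4 (λ N u r y → N :* u :* (r :* y) := u :* (y :* (N :* r)))
                                             refl N u (1ℚ - q) Pⁿ ⟩
  u * (Pⁿ * (N * (1ℚ - q)))       ≡⟨ cong (λ z → u * (Pⁿ * z)) 1+N[1-P]≡N[1-q] ⟨
  u * (Pⁿ * (1ℚ + N * (1ℚ - P)))  ≤⟨ *-monoˡ-≤-nonNeg u {{normalize-nonNeg 1 (suc n)}}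
                                       (x^n[1+n[1-x]]≤1 (suc n) 0≤P P≤1) ⟩
  u * 1ℚ                          ≡⟨ *-identityʳ u ⟩
  u                               ∎
  where
  open ≤-Reasoning
  open +-*-Solver
  u N P Pⁿ : ℚ
  u = + 1 / suc n
  N = fromℕ (suc n)
  P = q + u
  Pⁿ = P ^ suc n
  0≤P : 0ℚ ≤ℚ P
  0≤P = ≤-trans 0≤q (0≤q⇒p≤p+q q (+m/n-nonNeg 1 (suc n)))
  1+N[1-P]≡N[1-q] : 1ℚ + N * (1ℚ - P) ≡ N * (1ℚ - q)
  1+N[1-P]≡N[1-q] = begin-equality
    1ℚ + N * (1ℚ - (q + u))     ≡⟨ solve 3 (λ N q u → con 1ℚ :+ N :* (con 1ℚ :- (q :+ u))
                                                    := N :* (con 1ℚ :- q) :+ (con 1ℚ :- N :* u))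
                                         refl N q u ⟩
    N * (1ℚ - q) + (1ℚ - N * u) ≡⟨ cong (λ z → N * (1ℚ - q) + (1ℚ - z)) ([1+n]*[1/[1+n]]≡1 n) ⟩
    N * (1ℚ - q) + 0ℚ           ≡⟨ +-identityʳ _ ⟩
    N * (1ℚ - q)                ∎

lemma4 : (c : ℕ) → 1 ≤ c → (q : ℚ) → 0ℚ <ℚ q → q <ℚ (+ c) / suc c →
           Σ ℚ (λ p′ → p′ <ℚ 1ℚ ×
             ((d : ℕ) (k : ℕ → ℕ) → (∀ ℓ → ℓ < d → c < k ℓ) →
              ∀ i → i ≤ d → p d k q i ≤ℚ p′))
lemma4 c _ q 0<q q<c/[1+c] =
  P , P<1 , λ d k c<k i i≤d → proj₂ (p∈[0,P] 0≤q q≤P (<⇒≤ P<1) fP≤P d k c<k i i≤d)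
  where
  u P : ℚ
  u = + 1 / suc c
  P = q + u
  0≤q : 0ℚ ≤ℚ q
  0≤q = <⇒≤ 0<q
  q≤P : q ≤ℚ P
  q≤P = 0≤q⇒p≤p+q q (+m/n-nonNeg 1 (suc c))
  P<1 : P <ℚ 1ℚ
  P<1 = subst (P <ℚ_) (n/[1+n]+1/[1+n]≡1 c) (+-monoˡ-< u q<c/[1+c])
  fP≤P : q + (1ℚ - q) * P ^ suc c ≤ℚ P
  fP≤P = +-monoʳ-≤ q ([1-q]*[q+1/[1+n]]^[1+n]≤1/[1+n] c 0≤q (<⇒≤ P<1))
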